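{- Let $\pi$ be a non-decreasing parking function of length $n$, written as a word $\pi=i^{m_i}j^{m_j}\cdots r^{m_r}$ where $i<j<\cdots<r$ are the distinct letters of $\pi$ and $m_i,m_j,\ldots,m_r$ their multiplicities. Then $${\bf P}^\pi*{\bf J}_n={\bf J}_{m_i}{\bf J}_{m_j}\cdots{\bf J}_{m_r}.$$
   Context: A parking function of length $n$ is a word ${\bf a}=a_1\cdots a_n$ of positive integers whose non-decreasing rearrangement ${\bf a}^\uparrow=a'_1\cdots a'_n$ satisfies $a'_i\le i$. Parkization: for a word $w=w_1\cdots w_n$ over a totally ordered set $B$ in which every element has an immediate successor, let $\delta(x,y)\in\mathbb{N}\cup\{\infty\}$ ($x<y$) be the number of successor steps from $x$ to $y$ ($\infty$ if never reached); with distinct letters $b_1<\cdots<b_k$ of $w$ set $p(b_1)=1$, $p(b_{j+1})=\min(p(b_j)+\delta(b_j,b_{j+1}),1+\#\{i:w_i\le b_j\})$, and ${\rm Park}(w)=p(w_1)\cdots p(w_n)$ (for integer words $\delta(x,y)=y-x$). ${\bf PQSym}$ has basis $({\bf F}_{\bf a})$ over all parking functions, product ${\bf F}_{{\bf a}'}{\bf F}_{{\bf a}''}=\sum_{{\bf a}\in{\bf a}'\sqcup\!\sqcup({\bf a}''[k])}{\bf F}_{\bf a}$ ($k$ the length of ${\bf a}'$, $v[k]$ adds $k$ to each letter, shuffle with multiplicity), and on degree $n$ the internal product ${\bf F}_{{\bf a}'}*{\bf F}_{{\bf a}''}={\bf F}_{{\rm Park}({\bf a}'\otimes{\bf a}'')}$,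 where ${\bf a}'\otimes{\bf a}''=(a'_1,a''_1)\cdots(a'_n,a''_n)$ over $\mathbb{Z}_{>0}^2$ with lexicographic order (successor of $(i,j)$ is $(i,j+1)$). ${\bf P}^\pi=\sum_{{\bf a}^\uparrow=\pi}{\bf F}_{\bf a}$, and ${\bf J}_m={\bf P}^{(1^m)}={\bf F}_{1\cdots1}$ (word of $m$ ones). -}

module Defs where

open import Data.Nat using (ℕ; zero; suc; _+_; _∸_; _≤_; _<ᵇ_; _≡ᵇ_; _⊓_)
open import Data.Nat.Properties using (≤-decTotalOrder; ≤-totalOrder; _≤?_; _≟_)
open import Data.Bool using (Bool; true; false; _∧_; _∨_; if_then_else_; not)
open import Data.Maybe using (Maybe; just; nothing)
open import Data.Product using (_×_; _,_)
open import Data.Unit using (⊤)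
open import Data.List using (List; []; _∷_; _++_; map; concatMap; filter; length; zip; upTo; foldr)
import Data.List.Properties as LP
open import Relation.Nullary using (Dec; yes; no; does)
open import Relation.Nullary.Decidable using (_×-dec_)
open import Relation.Binary.PropositionalEquality using (_≡_)
import Data.List.Sort.MergeSort as MS
import Data.List.Relation.Unary.Sorted.TotalOrder as ST

Word : Set
Word = List ℕ

sortℕ : Word → Word
sortℕ = MS.sort ≤-decTotalOrder

NonDecreasing : Word → Set
NonDecreasing = ST.Sorted ≤-totalOrder

PFcond : ℕ → Word → Set
PFcond i []       = ⊤
PFcond i (x ∷ xs) = (1 ≤ x × x ≤ i) × PFcond (suc i) xs

IsParkingFunction : Word → Set
IsParkingFunction a = PFcond 1 (sortℕ a)

PFcond? : (i : ℕ) (w : Word) → Dec (PFcond i w)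
PFcond? i []       = yes _
PFcond? i (x ∷ xs) = ((1 ≤? x) ×-dec (x ≤? i)) ×-dec PFcond? (suc i) xs

isPF? : (a : Word) → Dec (IsParkingFunction a)
isPF? a = PFcond? 1 (sortℕ a)

-- Elements of PQSym with non-negative integer coefficients are
-- represented as multisets of parking functions: the list [a₁,…,a_m]
-- stands for F_{a₁} + ⋯ + F_{a_m}.  Equality of elements is equality
-- of multisets, i.e. permutation (_↭_) of the lists.

PQ : Set
PQ = List Word

F : Word → PQ
F a = a ∷ []

shuffle : Word → Word → List Word
shuffle []       v        = v ∷ []
shuffle (x ∷ u)  []       = (x ∷ u) ∷ []
shuffle (x ∷ u)  (y ∷ v)  = map (x ∷_) (shuffle u (y ∷ v)) ++ map (y ∷_) (shuffle (x ∷ u) v)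

shift : ℕ → Word → Word
shift k = map (k +_)

prodF : Word → Word → PQ
prodF a′ a″ = shuffle a′ (shift (length a′) a″)

_·_ : PQ → PQ → PQ
X · Y = concatMap (λ a′ → concatMap (λ a″ → prodF a′ a″) Y) X

-- Parkization of words over ℕ_{>0}², lexicographic order,
-- successor of (i,j) is (i,j+1)

Pair : Set
Pair = ℕ × ℕ

_≤ₚ_ : Pair → Pair → Bool
(i , j) ≤ₚ (i′ , j′) = (i <ᵇ i′) ∨ ((i ≡ᵇ i′) ∧ (j <ᵇ suc j′))

_≡ₚ_ : Pair → Pair → Bool
(i , j) ≡ₚ (i′ , j′) = (i ≡ᵇ i′) ∧ (j ≡ᵇ j′)

-- δ(x,y) for x < y : number of successor steps, nothing = ∞
δ : Pair → Pair → Maybe ℕ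
δ (i , j) (i′ , j′) = if i ≡ᵇ i′ then just (j′ ∸ j) else nothing

insertDistinct : Pair → List Pair → List Pair
insertDistinct x []       = x ∷ []
insertDistinct x (y ∷ ys) =
  if x ≡ₚ y then y ∷ ys
  else (if x ≤ₚ y then x ∷ y ∷ ys else y ∷ insertDistinct x ys)

distinctLetters : List Pair → List Pair
distinctLetters = foldr insertDistinct []

countLeq : Pair → List Pair → ℕ
countLeq b []       = 0
countLeq b (x ∷ xs) = if x ≤ₚ b then suc (countLeq b xs) else countLeq b xs

minδ : ℕ → Maybe ℕ → ℕ → ℕ
minδ p (just d) c = (p + d) ⊓ c
minδ p nothing  c = c

-- given w, the previous letter b_j with its value p(b_j), and the
-- remaining letters b_{j+1} < ⋯, compute the table of values p(b)
parkTable : List Pair → Pair → ℕ → List Pair → List (Pair × ℕ)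
parkTable w prev pprev []       = []
parkTable w prev pprev (b ∷ bs) =
  let pb = minδ pprev (δ prev b) (1 + countLeq prev w)
  in (b , pb) ∷ parkTable w b pb bs

table : List Pair → List (Pair × ℕ)
table w with distinctLetters w
... | []      = []
... | b ∷ bs  = (b , 1) ∷ parkTable w b 1 bs

lookupP : List (Pair × ℕ) → Pair → ℕ
lookupP []             x = 0
lookupP ((b , v) ∷ t)  x = if x ≡ₚ b then v else lookupP t x

Park : List Pair → Word
Park w = map (lookupP (table w)) w

_⊗_ : Word → Word → List Pair
a′ ⊗ a″ = zip a′ a″

_*_ : PQ → PQ → PQ
X * Y = concatMap (λ a′ → map (λ a″ → Park (a′ ⊗ a″)) Y) X

words : ℕ → ℕ → List Word
words zero    n = [] ∷ []
words (suc k) n = concatMap (λ w → map (λ x → suc x ∷ w) (upTo n)) (words k n)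

-- P^π = Σ_{a parking function, a↑ = π} F_a.  Every parking function of
-- length n = |π| has letters in {1,…,n}, so it suffices to range over
-- `words n n`.
P : Word → PQ
P π = filter (λ a → isPF? a ×-dec LP.≡-dec _≟_ (sortℕ a) π) (words (length π) (length π))

J : ℕ → PQ
J m = F (Data.List.replicate m 1)
  where import Data.List

prodList : List PQ → PQ
prodList = foldr _·_ (F [])

runs : ℕ → ℕ → Word → List ℕ
runs c m []       = m ∷ []
runs c m (x ∷ xs) = if x ≡ᵇ c then runs c (suc m) xs else m ∷ runs x 1 xs

multiplicities : Word → List ℕ
multiplicities []       = []
multiplicities (x ∷ xs) = runs x 1 xs

-- Every letter of a ⊗ 1ⁿ has second coordinate 1, so parkization never takes successor steps between
-- distinct letters and replaces each letter x of a by its rank 1 + #{i : a_i < x}.  Hence P^π * J_n is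
-- the sum of F over the rank words of the rearrangements a of π.  Ranking is injective on the letters
-- of π and turns π itself into 1^{m_i} (1+m_i)^{m_j} ⋯, so P^π * J_n lists each rearrangement of that
-- word exactly once.  So does J_{m_i} J_{m_j} ⋯: it is the sum of the shuffles of the blocks
-- 1^{m_i}, (1+m_i)^{m_j}, …, whose letters are pairwise distinct across blocks.
module Submission where

open import Defs
open import Data.Bool using (true; false; if_then_else_)
open import Data.Nat using (ℕ; zero; suc; _+_; _≤_; _<_; _<ᵇ_; _≡ᵇ_; z≤n; s≤s; s≤s⁻¹)
open import Data.Nat.Properties
  using (_≟_; _<?_; ≤-totalOrder; ≤-decTotalOrder; ≤-refl; ≤-trans; <⇒≤; <⇒≢; ≤⇒≯; ≮⇒≥; ≤∧≢⇒<;
         <-trans; <-≤-trans; ≤-<-trans; <-cmp; <-irrefl; suc-injective; m≤m+n; m≤n+m; n<1+n;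
         m≤n⇒m≤1+n; m≤n⇒m<n∨m≡n; +-suc; +-cancelˡ-≡; m+1+n≢0; <ᵇ-reflects-<; module ≤-Reasoning)
open import Data.Product using (_×_; _,_; proj₁; proj₂)
open import Data.Sum using (inj₁; inj₂; [_,_]′)
open import Data.List
  using (List; []; _∷_; [_]; _++_; map; concatMap; filter; length; replicate; upTo; foldr)
open import Data.List.Properties
  using (map-∘; map-cong; map-cong-local; map-injective; map-replicate; map-++; length-replicate;
         length-++; ++-identityʳ; ∷-injective; concatMap-map; concatMap-pure;
         filter-all; filter-none; filter-accept; filter-reject; filter-++)
open import Data.List.Membership.Propositional using (_∈_; find; lose)
open import Data.List.Membership.Propositional.Properties
  using (∈-∃++; ∈-map⁺; ∈-map⁻; ∈-++⁺ˡ; ∈-++⁺ʳ; ∈-++⁻; ∈-concatMap⁺; ∈-concatMap⁻; ∈-upTo⁺;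
         ∈-filter⁺; ∈-filter⁻)
open import Data.List.Membership.Propositional.Properties.WithK using (unique∧set⇒bag)
open import Data.List.Relation.Binary.BagAndSetEquality using (∼bag⇒↭)
open import Data.List.Relation.Binary.Subset.Propositional using (_⊆_)
open import Data.List.Relation.Unary.Any using (here; there)
open import Data.List.Relation.Unary.All as All using (All; []; _∷_)
import Data.List.Relation.Unary.All.Properties as AllP
open import Data.List.Relation.Unary.AllPairs using (AllPairs; []; _∷_)
open import Data.List.Relation.Unary.Unique.Propositional using (Unique)
import Data.List.Relation.Unary.Unique.Propositional.Properties as UniqueP
open import Data.List.Relation.Unary.Sorted.TotalOrder.Properties using (Sorted⇒AllPairs; ↗↭↗⇒≋)
open import Data.List.Relation.Binary.Pointwise using (Pointwise-≡⇒≡)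
open import Data.List.Relation.Binary.Permutation.Propositional
  using (_↭_; ↭-refl; ↭-sym; ↭-trans; ↭-reflexive; prep; ↭⇒↭ₛ; module PermutationReasoning)
import Data.List.Relation.Binary.Permutation.Propositional.Properties as ↭
open import Data.List.Sort.MergeSort.Properties ≤-decTotalOrder using (sort-↭; sort-↗)
open import Function using (_∘′_)
open import Function.Bundles using (mk⇔)
open import Level using (0ℓ)
open import Relation.Binary.Definitions using (tri<; tri≈; tri>)
open import Relation.Binary.PropositionalEquality
  using (_≡_; _≢_; refl; sym; trans; cong; cong₂; subst; subst₂; module ≡-Reasoning)
open import Relation.Nullary using (¬_; contradiction)
open import Relation.Nullary.Decidable using (yes; no; proof)
open import Relation.Nullary.Reflects using (Reflects; ofʸ; ofⁿ)
open import Relation.Unary using (Pred; Decidable; ∁)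
open import Relation.Unary.Properties using (∁?)

-- Uniqueness and rearrangements

Unique-map⁺-local : {A B : Set} {f : A → B} {xs : List A} →
  (∀ {x y} → x ∈ xs → y ∈ xs → f x ≡ f y → x ≡ y) → Unique xs → Unique (map f xs)
Unique-map⁺-local {xs = []} inj [] = []
Unique-map⁺-local {xs = x ∷ xs} inj (x∉xs ∷ xs!) =
  AllP.map⁺ (All.tabulate λ y∈xs fx≡fy → All.lookup x∉xs y∈xs (inj (here refl) (there y∈xs) fx≡fy))
  ∷ Unique-map⁺-local (λ x∈ y∈ → inj (there x∈) (there y∈)) xs!

Unique-concatMap⁺ : {A B : Set} {f : A → List B} {xs : List A} →
  (∀ {x} → x ∈ xs → Unique (f x)) →
  (∀ {x y z} → x ∈ xs → y ∈ xs → z ∈ f x → z ∈ f y → x ≡ y) →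
  Unique xs → Unique (concatMap f xs)
Unique-concatMap⁺ {xs = []} _ _ [] = []
Unique-concatMap⁺ {f = f} {x ∷ xs} f! disjoint (x∉xs ∷ xs!) =
  UniqueP.++⁺ (f! (here refl))
    (Unique-concatMap⁺ (λ y∈ → f! (there y∈)) (λ x∈ y∈ → disjoint (there x∈) (there y∈)) xs!)
    fx-disjoint
  where
  fx-disjoint : ∀ {z} → ¬ (z ∈ f x × z ∈ concatMap f xs)
  fx-disjoint (z∈fx , z∈rest) with find (∈-concatMap⁻ f z∈rest)
  ... | y , y∈xs , z∈fy = All.lookup x∉xs y∈xs (disjoint (here refl) (there y∈xs) z∈fx z∈fy)

map-injective-local : {A B : Set} {f : A → B} {w a b : List A} →
  (∀ {x y} → x ∈ w → y ∈ w → f x ≡ f y → x ≡ y) →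
  All (_∈ w) a → All (_∈ w) b → map f a ≡ map f b → a ≡ b
map-injective-local inj [] [] _ = refl
map-injective-local inj (x∈ ∷ a∈) (y∈ ∷ b∈) eq =
  cong₂ _∷_ (inj x∈ y∈ (proj₁ (∷-injective eq))) (map-injective-local inj a∈ b∈ (proj₂ (∷-injective eq)))

↭-replicate : {A : Set} {l : List A} (m : ℕ) (c : A) → l ↭ replicate m c → l ≡ replicate m c
↭-replicate m c l↭ = trans (all≡ (↭.All-resp-↭ (↭-sym l↭) (AllP.replicate⁺ m refl)))
                           (cong (λ k → replicate k c) (trans (↭.↭-length l↭) (length-replicate m)))
  where
  all≡ : ∀ {l} → All (_≡ c) l → l ≡ replicate (length l) c
  all≡ [] = refl
  all≡ (refl ∷ ps) = cong (c ∷_) (all≡ ps)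

record Rearrangements {A : Set} (xs : List (List A)) (w : List A) : Set where
  constructor rearrangements
  field
    unique : Unique xs
    ∈⇒↭ : ∀ {a} → a ∈ xs → a ↭ w
    ↭⇒∈ : ∀ {a} → a ↭ w → a ∈ xs

Rearrangements⇒↭ : {A : Set} {xs ys : List (List A)} {w : List A} →
  Rearrangements xs w → Rearrangements ys w → xs ↭ ys
Rearrangements⇒↭ (rearrangements xs! xs⇒ xs⇐) (rearrangements ys! ys⇒ ys⇐) =
  ∼bag⇒↭ (unique∧set⇒bag xs! ys! (mk⇔ (ys⇐ ∘′ xs⇒) (xs⇐ ∘′ ys⇒)))

Rearrangements-map : {A B : Set} {f : A → B} {xs : List (List A)} {w : List A} →
  (∀ {x y} → x ∈ w → y ∈ w → f x ≡ f y → x ≡ y) →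
  Rearrangements xs w → Rearrangements (map (map f) xs) (map f w)
Rearrangements-map {f = f} {xs} {w} inj (rearrangements xs! xs⇒ xs⇐) =
  rearrangements unique members⇒ members⇐
  where
  letters : ∀ {a} → a ∈ xs → All (_∈ w) a
  letters a∈ = All.tabulate (↭.∈-resp-↭ (xs⇒ a∈))
  unique : Unique (map (map f) xs)
  unique = Unique-map⁺-local (λ a∈ b∈ → map-injective-local inj (letters a∈) (letters b∈)) xs!
  members⇒ : ∀ {c} → c ∈ map (map f) xs → c ↭ map f w
  members⇒ c∈ with ∈-map⁻ (map f) c∈
  ... | a , a∈ , refl = ↭.map⁺ f (xs⇒ a∈)
  members⇐ : ∀ {c} → c ↭ map f w → c ∈ map (map f) xs
  members⇐ c↭ with ↭.↭-map-inv f (↭-sym c↭)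
  ... | a , refl , w↭a = ∈-map⁺ (map f) (xs⇐ (↭-sym w↭a))

-- Shuffles

∈-shuffle-consˡ : ∀ {x : ℕ} {u v w} → w ∈ shuffle u v → x ∷ w ∈ shuffle (x ∷ u) v
∈-shuffle-consˡ {u = []} {[]} (here refl) = here refl
∈-shuffle-consˡ {u = _ ∷ _} {[]} (here refl) = here refl
∈-shuffle-consˡ {v = _ ∷ _} w∈ = ∈-++⁺ˡ (∈-map⁺ _ w∈)

∈-shuffle-consʳ : ∀ {y : ℕ} {u v w} → w ∈ shuffle u v → y ∷ w ∈ shuffle u (y ∷ v)
∈-shuffle-consʳ {u = []} (here refl) = here refl
∈-shuffle-consʳ {y = y} {x ∷ u} {v} w∈ = ∈-++⁺ʳ (map (x ∷_) (shuffle u (y ∷ v))) (∈-map⁺ _ w∈)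

∈-shuffle⇒↭ : ∀ {u v w : Word} → w ∈ shuffle u v → w ↭ u ++ v
∈-shuffle⇒↭ {[]} (here refl) = ↭-refl
∈-shuffle⇒↭ {x ∷ u} {[]} (here refl) = ↭-reflexive (sym (++-identityʳ (x ∷ u)))
∈-shuffle⇒↭ {x ∷ u} {y ∷ v} w∈ with ∈-++⁻ (map (x ∷_) (shuffle u (y ∷ v))) w∈
... | inj₁ w∈ˡ with ∈-map⁻ (x ∷_) w∈ˡ
...   | w , w∈′ , refl = prep x (∈-shuffle⇒↭ {u} w∈′)
∈-shuffle⇒↭ {x ∷ u} {y ∷ v} w∈ | inj₂ w∈ʳ with ∈-map⁻ (y ∷_) w∈ʳ
...   | w , w∈′ , refl = ↭-trans (prep y (∈-shuffle⇒↭ {x ∷ u} w∈′)) (↭-sym (↭.shift y (x ∷ u) v))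

shuffle-unique : ∀ {Q : Pred ℕ 0ℓ} {u v} → All Q u → All (∁ Q) v → Unique (shuffle u v)
shuffle-unique {u = []} _ _ = [] ∷ []
shuffle-unique {u = _ ∷ _} {[]} _ _ = [] ∷ []
shuffle-unique {Q = Q} {x ∷ u} {y ∷ v} (qx ∷ qu) (¬qy ∷ ¬qv) =
  UniqueP.++⁺ (UniqueP.map⁺ tail-injective (shuffle-unique qu (¬qy ∷ ¬qv)))
              (UniqueP.map⁺ tail-injective (shuffle-unique (qx ∷ qu) ¬qv))
              heads-differ
  where
  tail-injective : ∀ {z : ℕ} {s t} → z ∷ s ≡ z ∷ t → s ≡ t
  tail-injective eq = proj₂ (∷-injective eq)
  heads-differ : ∀ {w} → ¬ (w ∈ map (x ∷_) (shuffle u (y ∷ v)) × w ∈ map (y ∷_) (shuffle (x ∷ u) v))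
  heads-differ (w∈ˡ , w∈ʳ) with ∈-map⁻ (x ∷_) w∈ˡ | ∈-map⁻ (y ∷_) w∈ʳ
  ... | _ , _ , refl | _ , _ , eq = ¬qy (subst Q (proj₁ (∷-injective eq)) qx)

module _ {Q : Pred ℕ 0ℓ} (Q? : Decidable Q) where

  ∈-shuffle-filter : ∀ w → w ∈ shuffle (filter Q? w) (filter (∁? Q?) w)
  ∈-shuffle-filter [] = here refl
  ∈-shuffle-filter (x ∷ w) with Q? x
  ... | yes _ = ∈-shuffle-consˡ {u = filter Q? w} (∈-shuffle-filter w)
  ... | no _ = ∈-shuffle-consʳ {u = filter Q? w} (∈-shuffle-filter w)

  shuffle-filter-∁ : ∀ {u v w} → All Q u → All (∁ Q) v → w ∈ shuffle u v → filter (∁? Q?) w ≡ v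
  shuffle-filter-∁ {[]} _ ¬qv (here refl) = filter-all (∁? Q?) ¬qv
  shuffle-filter-∁ {x ∷ u} {[]} qu _ (here refl) = filter-none (∁? Q?) (All.map (λ q ¬q → ¬q q) qu)
  shuffle-filter-∁ {x ∷ u} {y ∷ v} (qx ∷ qu) (¬qy ∷ ¬qv) w∈
    with ∈-++⁻ (map (x ∷_) (shuffle u (y ∷ v))) w∈
  ... | inj₁ w∈ˡ with ∈-map⁻ (x ∷_) w∈ˡ
  ...   | w , w∈′ , refl =
    trans (filter-reject (∁? Q?) (λ ¬qx → ¬qx qx)) (shuffle-filter-∁ qu (¬qy ∷ ¬qv) w∈′)
  shuffle-filter-∁ {x ∷ u} {y ∷ v} (qx ∷ qu) (¬qy ∷ ¬qv) w∈ | inj₂ w∈ʳ with ∈-map⁻ (y ∷_) w∈ʳ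
  ...   | w , w∈′ , refl =
    trans (filter-accept (∁? Q?) ¬qy) (cong (y ∷_) (shuffle-filter-∁ (qx ∷ qu) ¬qv w∈′))

  filter-↭-separated : ∀ {u v w} → All Q u → All (∁ Q) v → w ↭ u ++ v →
    filter Q? w ↭ u × filter (∁? Q?) w ↭ v
  filter-↭-separated {u} {v} qu ¬qv w↭ =
    ↭-trans (↭.filter-↭ Q? w↭) (↭-reflexive filter-left) ,
    ↭-trans (↭.filter-↭ (∁? Q?) w↭) (↭-reflexive filter-right)
    where
    filter-left : filter Q? (u ++ v) ≡ u
    filter-left = trans (filter-++ Q? u v)
      (trans (cong₂ _++_ (filter-all Q? qu) (filter-none Q? ¬qv)) (++-identityʳ u))
    filter-right : filter (∁? Q?) (u ++ v) ≡ v
    filter-right = trans (filter-++ (∁? Q?) u v)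
      (cong₂ _++_ (filter-none (∁? Q?) (All.map (λ q ¬q → ¬q q) qu)) (filter-all (∁? Q?) ¬qv))

-- Products of the J_m

blocks : List ℕ → Word
blocks [] = []
blocks (m ∷ ms) = replicate m 1 ++ shift m (blocks ms)

blocks-positive : ∀ ms → All (1 ≤_) (blocks ms)
blocks-positive [] = []
blocks-positive (m ∷ ms) =
  AllP.++⁺ (AllP.replicate⁺ m ≤-refl)
           (AllP.map⁺ (All.map (λ {y} 1≤y → ≤-trans 1≤y (m≤n+m y m)) (blocks-positive ms)))

shift-≢1 : ∀ {m v} → 1 ≤ m → All (1 ≤_) v → All (_≢ 1) (shift m v)
shift-≢1 {suc m} _ v⁺ = AllP.map⁺ (All.map (λ { {suc y} _ eq → m+1+n≢0 m (suc-injective eq) }) v⁺)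

J-· : ∀ m X → J m · X ≡ concatMap (λ y → shuffle (replicate m 1) (shift m y)) X
J-· m X = trans (++-identityʳ _)
  (cong (λ k → concatMap (λ y → shuffle (replicate m 1) (shift k y)) X) (length-replicate m))

Rearrangements-J-· : ∀ {m X v} → 1 ≤ m → All (1 ≤_) v →
  Rearrangements X v → Rearrangements (J m · X) (replicate m 1 ++ shift m v)
Rearrangements-J-· {m} {X} {v} 1≤m v⁺ (rearrangements X! X⇒ X⇐) =
  subst (λ Y → Rearrangements Y (ones ++ shift m v)) (sym (J-· m X))
        (rearrangements unique members⇒ members⇐)
  where
  ones = replicate m 1
  one? = _≟ 1
  f : Word → List Word
  f y = shuffle ones (shift m y)
  ones≡1 : All (_≡ 1) ones
  ones≡1 = AllP.replicate⁺ m refl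
  shifted≢1 : ∀ {y} → y ∈ X → All (_≢ 1) (shift m y)
  shifted≢1 y∈ = shift-≢1 1≤m (↭.All-resp-↭ (↭-sym (X⇒ y∈)) v⁺)
  unique : Unique (concatMap f X)
  unique = Unique-concatMap⁺ (λ y∈ → shuffle-unique ones≡1 (shifted≢1 y∈)) disjoint X!
    where
    disjoint : ∀ {y y′ z} → y ∈ X → y′ ∈ X → z ∈ f y → z ∈ f y′ → y ≡ y′
    disjoint y∈ y′∈ z∈ z∈′ = map-injective (+-cancelˡ-≡ m _ _)
      (trans (sym (shuffle-filter-∁ one? ones≡1 (shifted≢1 y∈) z∈))
             (shuffle-filter-∁ one? ones≡1 (shifted≢1 y′∈) z∈′))
  members⇒ : ∀ {z} → z ∈ concatMap f X → z ↭ ones ++ shift m v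
  members⇒ z∈ with find (∈-concatMap⁻ f z∈)
  ... | y , y∈ , z∈fy = ↭-trans (∈-shuffle⇒↭ {ones} z∈fy) (↭.++⁺ˡ ones (↭.map⁺ (m +_) (X⇒ y∈)))
  members⇐ : ∀ {z} → z ↭ ones ++ shift m v → z ∈ concatMap f X
  members⇐ {z} z↭ with filter-↭-separated one? ones≡1 (shift-≢1 1≤m v⁺) z↭
  ... | ones↭ , rest↭ with ↭.↭-map-inv (m +_) (↭-sym rest↭)
  ...   | y , rest≡ , v↭y = ∈-concatMap⁺ f (lose (X⇐ (↭-sym v↭y)) z∈fy)
    where
    z∈fy : z ∈ f y
    z∈fy = subst₂ (λ u w → z ∈ shuffle u w) (↭-replicate m 1 ones↭) rest≡ (∈-shuffle-filter one? z)

prodList-J-Rearrangements : ∀ ms → All (1 ≤_) ms → Rearrangements (prodList (map J ms)) (blocks ms)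
prodList-J-Rearrangements [] [] =
  rearrangements ([] ∷ []) (λ { (here refl) → ↭-refl }) (λ a↭ → here (↭.↭-empty-inv a↭))
prodList-J-Rearrangements (m ∷ ms) (1≤m ∷ ms⁺) =
  Rearrangements-J-· 1≤m (blocks-positive ms) (prodList-J-Rearrangements ms ms⁺)

-- The terms of P^π

InRange : ℕ → ℕ → Set
InRange n x = 1 ≤ x × x ≤ n

∈-words : ∀ k n {w} → length w ≡ k → All (InRange n) w → w ∈ words k n
∈-words zero n {[]} refl [] = here refl
∈-words (suc k) n {suc x ∷ w} refl ((s≤s z≤n , x<n) ∷ w-in) =
  ∈-concatMap⁺ _ (lose (∈-words k n refl w-in) (∈-map⁺ (λ y → suc y ∷ w) (∈-upTo⁺ x<n)))

words-unique : ∀ k n → Unique (words k n)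
words-unique zero n = [] ∷ []
words-unique (suc k) n =
  Unique-concatMap⁺ (λ _ → UniqueP.map⁺ head-injective (UniqueP.upTo⁺ n)) same-tail (words-unique k n)
  where
  head-injective : ∀ {x y w} → suc x ∷ w ≡ suc y ∷ w → x ≡ y
  head-injective eq = suc-injective (proj₁ (∷-injective eq))
  same-tail : ∀ {w w′ z} → w ∈ words k n → w′ ∈ words k n →
    z ∈ map (λ x → suc x ∷ w) (upTo n) → z ∈ map (λ x → suc x ∷ w′) (upTo n) → w ≡ w′
  same-tail _ _ z∈ z∈′ with ∈-map⁻ _ z∈ | ∈-map⁻ _ z∈′
  ... | _ , _ , refl | _ , _ , eq = proj₂ (∷-injective eq)

PFcond-InRange : ∀ i l → PFcond (suc i) l → All (InRange (i + length l)) l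
PFcond-InRange i [] _ = []
PFcond-InRange i (x ∷ l) ((1≤x , x≤1+i) , pf) =
  (1≤x , ≤-trans x≤1+i (subst (suc i ≤_) (sym (+-suc i (length l))) (s≤s (m≤m+n i (length l)))))
  ∷ subst (λ k → All (InRange k) l) (sym (+-suc i (length l))) (PFcond-InRange (suc i) l pf)

parkingFunction-InRange : ∀ {a} → IsParkingFunction a → All (InRange (length a)) a
parkingFunction-InRange {a} pf = ↭.All-resp-↭ (sort-↭ a)
  (subst (λ k → All (InRange k) (sortℕ a)) (↭.↭-length (sort-↭ a)) (PFcond-InRange 0 (sortℕ a) pf))

sortℕ-unique : ∀ {a π} → NonDecreasing π → a ↭ π → sortℕ a ≡ π
sortℕ-unique {a} π↗ a↭π =
  Pointwise-≡⇒≡ (↗↭↗⇒≋ ≤-totalOrder (sort-↗ a) π↗ (↭⇒↭ₛ (↭-trans (sort-↭ a) a↭π)))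

P-Rearrangements : ∀ {π} → IsParkingFunction π → NonDecreasing π → Rearrangements (P π) π
P-Rearrangements {π} pf π↗ =
  rearrangements (UniqueP.filter⁺ _ (words-unique (length π) (length π))) members⇒ members⇐
  where
  members⇒ : ∀ {a} → a ∈ P π → a ↭ π
  members⇒ {a} a∈ with ∈-filter⁻ _ {xs = words (length π) (length π)} a∈
  ... | _ , _ , sorted≡π = ↭-trans (↭-sym (sort-↭ a)) (↭-reflexive sorted≡π)
  members⇐ : ∀ {a} → a ↭ π → a ∈ P π
  members⇐ a↭π = ∈-filter⁺ _ a-word (a-parking , sortℕ-unique π↗ a↭π)
    where
    a-word = ∈-words (length π) (length π) (↭.↭-length a↭π)
                     (↭.All-resp-↭ (↭-sym a↭π) (parkingFunction-InRange pf))
    a-parking = subst (PFcond 1) (trans (sortℕ-unique π↗ ↭-refl) (sym (sortℕ-unique π↗ a↭π))) pf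

-- Ranks

countBelow : ℕ → Word → ℕ
countBelow x a = length (filter (_<? x) a)

rank : Word → ℕ → ℕ
rank a x = suc (countBelow x a)

countBelow-∷-< : ∀ {x z a} → z < x → countBelow x (z ∷ a) ≡ suc (countBelow x a)
countBelow-∷-< z<x = cong length (filter-accept (_<? _) z<x)

countBelow-∷-≮ : ∀ {x z a} → ¬ z < x → countBelow x (z ∷ a) ≡ countBelow x a
countBelow-∷-≮ z≮x = cong length (filter-reject (_<? _) z≮x)

countBelow-↭ : ∀ x {a b} → a ↭ b → countBelow x a ≡ countBelow x b
countBelow-↭ x a↭b = ↭.↭-length (↭.filter-↭ (_<? x) a↭b)

countBelow-++ : ∀ x a b → countBelow x (a ++ b) ≡ countBelow x a + countBelow x b
countBelow-++ x a b = trans (cong length (filter-++ (_<? x) a b)) (length-++ (filter (_<? x) a))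

countBelow-none : ∀ {x a} → All (x ≤_) a → countBelow x a ≡ 0
countBelow-none x≤a = cong length (filter-none (_<? _) (All.map ≤⇒≯ x≤a))

countBelow-all : ∀ {x a} → All (_< x) a → countBelow x a ≡ length a
countBelow-all a<x = cong length (filter-all (_<? _) a<x)

countBelow-mono-≤ : ∀ {x y} a → x ≤ y → countBelow x a ≤ countBelow y a
countBelow-mono-≤ [] _ = z≤n
countBelow-mono-≤ {x} {y} (z ∷ a) x≤y with z <? x | z <? y
... | yes z<x | yes z<y rewrite countBelow-∷-< {a = a} z<x | countBelow-∷-< {a = a} z<y =
  s≤s (countBelow-mono-≤ a x≤y)
... | yes z<x | no z≮y = contradiction (<-≤-trans z<x x≤y) z≮y
... | no z≮x | yes z<y rewrite countBelow-∷-≮ {a = a} z≮x | countBelow-∷-< {a = a} z<y =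
  m≤n⇒m≤1+n (countBelow-mono-≤ a x≤y)
... | no z≮x | no z≮y rewrite countBelow-∷-≮ {a = a} z≮x | countBelow-∷-≮ {a = a} z≮y =
  countBelow-mono-≤ a x≤y

countBelow-mono-< : ∀ {x y a} → x < y → x ∈ a → countBelow x a < countBelow y a
countBelow-mono-< {x} {y} x<y x∈ with ∈-∃++ x∈
... | l , r , refl = begin-strict
  countBelow x (l ++ [ x ] ++ r)  ≡⟨ countBelow-↭ x (↭.shift x l r) ⟩
  countBelow x (x ∷ l ++ r)       ≡⟨ countBelow-∷-≮ {x} {a = l ++ r} (<-irrefl refl) ⟩
  countBelow x (l ++ r)           ≤⟨ countBelow-mono-≤ (l ++ r) (<⇒≤ x<y) ⟩
  countBelow y (l ++ r)           <⟨ n<1+n _ ⟩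
  suc (countBelow y (l ++ r))     ≡⟨ countBelow-∷-< {a = l ++ r} x<y ⟨
  countBelow y (x ∷ l ++ r)       ≡⟨ countBelow-↭ y (↭.shift x l r) ⟨
  countBelow y (l ++ [ x ] ++ r)  ∎
  where open ≤-Reasoning

rank-injective : ∀ {a x y} → x ∈ a → y ∈ a → rank a x ≡ rank a y → x ≡ y
rank-injective {x = x} {y} x∈ y∈ eq with <-cmp x y
... | tri< x<y _ _ = contradiction (suc-injective eq) (<⇒≢ (countBelow-mono-< x<y x∈))
... | tri≈ _ x≡y _ = x≡y
... | tri> _ _ y<x = contradiction (sym (suc-injective eq)) (<⇒≢ (countBelow-mono-< y<x y∈))

-- Parkization of words with constant second coordinate

flat : ℕ → Pair
flat x = x , 1

≡ᵇ-reflects-≡ : ∀ x y → Reflects (x ≡ y) (x ≡ᵇ y)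
≡ᵇ-reflects-≡ x y = proof (x ≟ y)

flat-≡ₚ : ∀ x y → Reflects (x ≡ y) (flat x ≡ₚ flat y)
flat-≡ₚ x y with x ≡ᵇ y | ≡ᵇ-reflects-≡ x y
... | true | ofʸ x≡y = ofʸ x≡y
... | false | ofⁿ x≢y = ofⁿ x≢y

flat-≤ₚ : ∀ x y → Reflects (x ≤ y) (flat x ≤ₚ flat y)
flat-≤ₚ x y with x <ᵇ y | <ᵇ-reflects-< x y | x ≡ᵇ y | ≡ᵇ-reflects-≡ x y
... | true | ofʸ x<y | _ | _ = ofʸ (<⇒≤ x<y)
... | false | _ | true | ofʸ refl = ofʸ ≤-refl
... | false | ofⁿ x≮y | false | ofⁿ x≢y = ofⁿ λ x≤y → [ x≮y , x≢y ]′ (m≤n⇒m<n∨m≡n x≤y)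

countLeq-flat : ∀ x a → countLeq (flat x) (map flat a) ≡ countBelow (suc x) a
countLeq-flat x [] = refl
countLeq-flat x (y ∷ a) with flat y ≤ₚ flat x | flat-≤ₚ y x
... | true | ofʸ y≤x = trans (cong suc (countLeq-flat x a)) (sym (countBelow-∷-< (s≤s y≤x)))
... | false | ofⁿ y≰x = trans (countLeq-flat x a) (sym (countBelow-∷-≮ (λ y<1+x → y≰x (s≤s⁻¹ y<1+x))))

insertℕ : ℕ → List ℕ → List ℕ
insertℕ x [] = x ∷ []
insertℕ x (y ∷ ys) = if x ≡ᵇ y then y ∷ ys else (if x <ᵇ y then x ∷ y ∷ ys else y ∷ insertℕ x ys)

distinctℕ : Word → List ℕ
distinctℕ = foldr insertℕ []

insertDistinct-flat : ∀ x ys → insertDistinct (flat x) (map flat ys) ≡ map flat (insertℕ x ys)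
insertDistinct-flat x [] = refl
insertDistinct-flat x (y ∷ ys) with x ≡ᵇ y | x <ᵇ y
... | true | _ = refl
... | false | true = refl
... | false | false = cong (flat y ∷_) (insertDistinct-flat x ys)

distinctLetters-flat : ∀ a → distinctLetters (map flat a) ≡ map flat (distinctℕ a)
distinctLetters-flat [] = refl
distinctLetters-flat (x ∷ a) =
  trans (cong (insertDistinct (flat x)) (distinctLetters-flat a)) (insertDistinct-flat x (distinctℕ a))

insertℕ-⊆ : ∀ x ys → insertℕ x ys ⊆ x ∷ ys
insertℕ-⊆ x [] z∈ = z∈
insertℕ-⊆ x (y ∷ ys) z∈ with x ≡ᵇ y | x <ᵇ y | z∈
... | true | _ | z∈′ = there z∈′
... | false | true | z∈′ = z∈′
... | false | false | here z≡y = there (here z≡y)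
... | false | false | there z∈′ with insertℕ-⊆ x ys z∈′
...   | here z≡x = here z≡x
...   | there z∈ys = there (there z∈ys)

⊆-insertℕ : ∀ x ys → x ∷ ys ⊆ insertℕ x ys
⊆-insertℕ x [] z∈ = z∈
⊆-insertℕ x (y ∷ ys) z∈ with x ≡ᵇ y | ≡ᵇ-reflects-≡ x y | x <ᵇ y | z∈
... | true | ofʸ refl | _ | here z≡x = here z≡x
... | true | ofʸ refl | _ | there z∈ys = z∈ys
... | false | _ | true | z∈′ = z∈′
... | false | _ | false | here z≡x = there (⊆-insertℕ x ys (here z≡x))
... | false | _ | false | there (here z≡y) = here z≡y
... | false | _ | false | there (there z∈ys) = there (⊆-insertℕ x ys (there z∈ys))

insertℕ-sorted : ∀ x {ys} → AllPairs _<_ ys → AllPairs _<_ (insertℕ x ys)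
insertℕ-sorted x [] = [] ∷ []
insertℕ-sorted x {y ∷ ys} (y<ys ∷ ys↗) with x ≡ᵇ y | ≡ᵇ-reflects-≡ x y | x <ᵇ y | <ᵇ-reflects-< x y
... | true | _ | _ | _ = y<ys ∷ ys↗
... | false | _ | true | ofʸ x<y = (x<y ∷ All.map (<-trans x<y) y<ys) ∷ y<ys ∷ ys↗
... | false | ofⁿ x≢y | false | ofⁿ x≮y = All.tabulate y<inserted ∷ insertℕ-sorted x ys↗
  where
  y<inserted : ∀ {z} → z ∈ insertℕ x ys → y < z
  y<inserted z∈ with insertℕ-⊆ x ys z∈
  ... | here refl = ≤∧≢⇒< (≮⇒≥ x≮y) (λ y≡x → x≢y (sym y≡x))
  ... | there z∈ys = All.lookup y<ys z∈ys

distinctℕ-sorted : ∀ a → AllPairs _<_ (distinctℕ a)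
distinctℕ-sorted [] = []
distinctℕ-sorted (x ∷ a) = insertℕ-sorted x (distinctℕ-sorted a)

⊆-distinctℕ : ∀ a → a ⊆ distinctℕ a
⊆-distinctℕ (x ∷ a) (here refl) = ⊆-insertℕ x (distinctℕ a) (here refl)
⊆-distinctℕ (x ∷ a) (there y∈) = ⊆-insertℕ x (distinctℕ a) (there (⊆-distinctℕ a y∈))

flatTable : (ℕ → ℕ) → List ℕ → List (Pair × ℕ)
flatTable f = map (λ b → flat b , f b)

lookupP-flatTable : ∀ f {x} bs → x ∈ bs → lookupP (flatTable f bs) (flat x) ≡ f x
lookupP-flatTable f {x} (b ∷ bs) x∈ with flat x ≡ₚ flat b | flat-≡ₚ x b
... | true | ofʸ refl = refl
... | false | ofⁿ x≢b with x∈
...   | here x≡b = contradiction x≡b x≢b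
...   | there x∈bs = lookupP-flatTable f bs x∈bs

countBelow-gap : ∀ {x x′} a → x < x′ → (∀ {y} → y ∈ a → x < y → x′ ≤ y) →
  countBelow (suc x) a ≡ countBelow x′ a
countBelow-gap [] _ _ = refl
countBelow-gap {x} {x′} (z ∷ a) x<x′ gap with z <? suc x | countBelow-gap a x<x′ (λ y∈ → gap (there y∈))
... | yes z<1+x | ih =
  trans (countBelow-∷-< z<1+x) (trans (cong suc ih) (sym (countBelow-∷-< (≤-<-trans (s≤s⁻¹ z<1+x) x<x′))))
... | no z≮1+x | ih =
  trans (countBelow-∷-≮ z≮1+x) (trans ih (sym (countBelow-∷-≮ (≤⇒≯ (gap (here refl) (≮⇒≥ z≮1+x))))))

-- As every second coordinate is 1, δ between distinct letters is ∞, so p(b_{j+1}) = 1 + #{i : w_i ≤ b_j};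
-- no letter lies strictly between b_j and b_{j+1}, so this is the rank of b_{j+1}.
parkTable-flat : ∀ a prev p bs → AllPairs _<_ (prev ∷ bs) → (∀ {y} → y ∈ a → prev < y → y ∈ bs) →
  parkTable (map flat a) (flat prev) p (map flat bs) ≡ flatTable (rank a) bs
parkTable-flat a prev p [] _ _ = refl
parkTable-flat a prev p (b ∷ bs) ((prev<b ∷ _) ∷ b↗@(b<bs ∷ _)) above
  with prev ≡ᵇ b | ≡ᵇ-reflects-≡ prev b
... | true | ofʸ prev≡b = contradiction prev≡b (<⇒≢ prev<b)
... | false | ofⁿ _ =
  cong₂ _∷_ (cong (λ k → flat b , suc k) (trans (countLeq-flat prev a) (countBelow-gap a prev<b b≤above)))
            (parkTable-flat a b _ bs b↗ above-b)
  where
  b≤above : ∀ {y} → y ∈ a → prev < y → b ≤ y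
  b≤above y∈ prev<y with above y∈ prev<y
  ... | here refl = ≤-refl
  ... | there y∈bs = <⇒≤ (All.lookup b<bs y∈bs)
  above-b : ∀ {y} → y ∈ a → b < y → y ∈ bs
  above-b y∈ b<y with above y∈ (<-trans prev<b b<y)
  ... | here refl = contradiction b<y (<-irrefl refl)
  ... | there y∈bs = y∈bs

table-flat : ∀ a → table (map flat a) ≡ flatTable (rank a) (distinctℕ a)
table-flat a = from-letters (distinctℕ a) (distinctℕ-sorted a) (⊆-distinctℕ a) (distinctLetters-flat a)
  where
  from-letters : ∀ ds → AllPairs _<_ ds → a ⊆ ds → distinctLetters (map flat a) ≡ map flat ds →
    table (map flat a) ≡ flatTable (rank a) ds
  from-letters ds ds↗ a⊆ds eq with distinctLetters (map flat a)
  from-letters [] _ _ refl | _ = refl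
  from-letters (b ∷ ds) (b<ds ∷ ds↗) a⊆ds refl | _ =
    cong₂ _∷_ (cong (λ k → flat b , suc k) (sym (countBelow-none (All.tabulate b≤a))))
              (parkTable-flat a b 1 ds (b<ds ∷ ds↗) above)
    where
    b≤a : ∀ {y} → y ∈ a → b ≤ y
    b≤a y∈ with a⊆ds y∈
    ... | here refl = ≤-refl
    ... | there y∈ds = <⇒≤ (All.lookup b<ds y∈ds)
    above : ∀ {y} → y ∈ a → b < y → y ∈ ds
    above y∈ b<y with a⊆ds y∈
    ... | here refl = contradiction b<y (<-irrefl refl)
    ... | there y∈ds = y∈ds

Park-flat : ∀ a → Park (map flat a) ≡ map (rank a) a
Park-flat a = begin
  map (lookupP (table (map flat a))) (map flat a)  ≡⟨ cong (λ t → map (lookupP t) (map flat a)) (table-flat a) ⟩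
  map (lookupP ranks) (map flat a)                 ≡⟨ map-∘ a ⟨
  map (λ x → lookupP ranks (flat x)) a             ≡⟨ map-cong-local (All.tabulate lookup-rank) ⟩
  map (rank a) a                                   ∎
  where
  open ≡-Reasoning
  ranks = flatTable (rank a) (distinctℕ a)
  lookup-rank : ∀ {x} → x ∈ a → lookupP ranks (flat x) ≡ rank a x
  lookup-rank x∈ = lookupP-flatTable (rank a) _ (⊆-distinctℕ a x∈)

⊗-ones : ∀ a → a ⊗ replicate (length a) 1 ≡ map flat a
⊗-ones [] = refl
⊗-ones (x ∷ a) = cong (flat x ∷_) (⊗-ones a)

Park-⊗-ones : ∀ {a π} → a ↭ π → Park (a ⊗ replicate (length π) 1) ≡ map (rank π) a
Park-⊗-ones {a} {π} a↭π = begin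
  Park (a ⊗ replicate (length π) 1) ≡⟨ cong (λ n → Park (a ⊗ replicate n 1)) (↭.↭-length a↭π) ⟨
  Park (a ⊗ replicate (length a) 1) ≡⟨ cong Park (⊗-ones a) ⟩
  Park (map flat a)                 ≡⟨ Park-flat a ⟩
  map (rank a) a                    ≡⟨ map-cong (λ x → cong suc (countBelow-↭ x a↭π)) a ⟩
  map (rank π) a                    ∎
  where open ≡-Reasoning

-- Multiplicities

replicate-++-∷ : ∀ m (c : ℕ) xs → replicate m c ++ c ∷ xs ≡ c ∷ replicate m c ++ xs
replicate-++-∷ zero c xs = refl
replicate-++-∷ (suc m) c xs = cong (c ∷_) (replicate-++-∷ m c xs)

map-rank-replicate : ∀ {L c} m → All (c ≤_) L → map (rank L) (replicate m c) ≡ replicate m 1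
map-rank-replicate m c≤L = trans (map-replicate _ m _) (cong (λ k → replicate m (suc k)) (countBelow-none c≤L))

rank-++-above : ∀ {u v y} → All (_< y) u → rank (u ++ v) y ≡ length u + rank v y
rank-++-above {u} {v} {y} u<y = begin
  suc (countBelow y (u ++ v))            ≡⟨ cong suc (countBelow-++ y u v) ⟩
  suc (countBelow y u + countBelow y v)  ≡⟨ cong (λ k → suc (k + countBelow y v)) (countBelow-all u<y) ⟩
  suc (length u + countBelow y v)        ≡⟨ +-suc (length u) _ ⟨
  length u + rank v y                    ∎
  where open ≡-Reasoning

blocks-runs : ∀ c m xs → AllPairs _≤_ (c ∷ xs) →
  blocks (runs c m xs) ≡ map (rank (replicate m c ++ xs)) (replicate m c ++ xs)
blocks-runs c m [] _ = begin
  replicate m 1 ++ []                 ≡⟨ cong (_++ []) (map-rank-replicate m c≤L) ⟨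
  map (rank L) (replicate m c) ++ []  ≡⟨ map-++ (rank L) (replicate m c) [] ⟨
  map (rank L) L                      ∎
  where
  open ≡-Reasoning
  L = replicate m c ++ []
  c≤L : All (c ≤_) L
  c≤L = AllP.++⁺ (AllP.replicate⁺ m ≤-refl) []
blocks-runs c m (x ∷ xs) ((c≤x ∷ c≤xs) ∷ x≤xs ∷ xs↗) with x ≡ᵇ c | ≡ᵇ-reflects-≡ x c
... | true | ofʸ refl = subst (λ L → blocks (runs c (suc m) xs) ≡ map (rank L) L) (sym (replicate-++-∷ m c xs))
  (blocks-runs c (suc m) xs (c≤xs ∷ xs↗))
... | false | ofⁿ x≢c = begin
  replicate m 1 ++ shift m (blocks (runs x 1 xs))
    ≡⟨ cong (λ w → replicate m 1 ++ shift m w) (blocks-runs x 1 xs (x≤xs ∷ xs↗)) ⟩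
  replicate m 1 ++ shift m (map (rank (x ∷ xs)) (x ∷ xs))
    ≡⟨ cong₂ _++_ (map-rank-replicate m c≤L) shifted-ranks ⟨
  map (rank L) (replicate m c) ++ map (rank L) (x ∷ xs)
    ≡⟨ map-++ (rank L) (replicate m c) (x ∷ xs) ⟨
  map (rank L) L
    ∎
  where
  open ≡-Reasoning
  L = replicate m c ++ x ∷ xs
  c≤L : All (c ≤_) L
  c≤L = AllP.++⁺ (AllP.replicate⁺ m ≤-refl) (c≤x ∷ c≤xs)
  c<x : c < x
  c<x = ≤∧≢⇒< c≤x (λ c≡x → x≢c (sym c≡x))
  shifted-ranks : map (rank L) (x ∷ xs) ≡ shift m (map (rank (x ∷ xs)) (x ∷ xs))
  shifted-ranks = trans (map-cong-local (All.tabulate rank-shift)) (map-∘ (x ∷ xs))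
    where
    rank-shift : ∀ {y} → y ∈ x ∷ xs → rank L y ≡ m + rank (x ∷ xs) y
    rank-shift y∈ = trans (rank-++-above (AllP.replicate⁺ m (<-≤-trans c<x (All.lookup (≤-refl ∷ x≤xs) y∈))))
                          (cong (_+ _) (length-replicate m))

blocks-multiplicities : ∀ {π} → NonDecreasing π → blocks (multiplicities π) ≡ map (rank π) π
blocks-multiplicities {[]} _ = refl
blocks-multiplicities {c ∷ xs} π↗ = blocks-runs c 1 xs (Sorted⇒AllPairs ≤-totalOrder π↗)

runs-positive : ∀ c m xs → 1 ≤ m → All (1 ≤_) (runs c m xs)
runs-positive c m [] 1≤m = 1≤m ∷ []
runs-positive c m (x ∷ xs) 1≤m with x ≡ᵇ c
... | true = runs-positive c (suc m) xs (s≤s z≤n)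
... | false = 1≤m ∷ runs-positive x 1 xs ≤-refl

multiplicities-positive : ∀ π → All (1 ≤_) (multiplicities π)
multiplicities-positive [] = []
multiplicities-positive (c ∷ xs) = runs-positive c 1 xs ≤-refl

*-J : ∀ X n → X * J n ≡ map (λ a → Park (a ⊗ replicate n 1)) X
*-J X n = trans (sym (concatMap-map [_] _ X)) (concatMap-pure _)

mainTheorem6 : (n : ℕ) (π : Word) → length π ≡ n → IsParkingFunction π → NonDecreasing π →
    (P π * J n) ↭ prodList (map J (multiplicities π))
mainTheorem6 _ π refl pf π↗ = begin
  P π * J (length π)                   ≡⟨ *-J (P π) (length π) ⟩
  map (λ a → Park (a ⊗ ones)) (P π)    ≡⟨ map-cong-local (All.tabulate (Park-⊗-ones ∘′ ∈⇒↭)) ⟩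
  map (map (rank π)) (P π)             ↭⟨ Rearrangements⇒↭ ranked blocks-J ⟩
  prodList (map J (multiplicities π))  ∎
  where
  open PermutationReasoning
  ones = replicate (length π) 1
  P-π = P-Rearrangements pf π↗
  open Rearrangements P-π using (∈⇒↭)
  ranked : Rearrangements (map (map (rank π)) (P π)) (blocks (multiplicities π))
  ranked = subst (Rearrangements _) (sym (blocks-multiplicities π↗)) (Rearrangements-map rank-injective P-π)
  blocks-J = prodList-J-Rearrangements (multiplicities π) (multiplicities-positive π)
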